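{- If a connected graph $G$ contains neither a diamond nor a pan as an induced subgraph, then an ordering of $V(G)$ is a DFS ordering of $G$ if and only if it is a LexDFS ordering of $G$.
   Context: All graphs are finite and simple. For an ordering $\sigma$ of $V(G)$ write $x<_\sigma y$ if $x$ precedes $y$. $\sigma$ is a DFS ordering if whenever $a<_\sigma b<_\sigma c$, $ac\in E(G)$, $ab\notin E(G)$, there is $d$ with $a<_\sigma d<_\sigma b$ and $db\in E(G)$; it is a LexDFS ordering if under the same conditions there is $d$ with $a<_\sigma d<_\sigma b$, $db\in E(G)$ and $dc\notin E(G)$. For $k\ge3$ a $k$-pan is a $k$-cycle plus one extra vertex adjacent to exactly one cycle vertex; a pan is a $k$-pan for some $k\ge 3$. The diamond is $K_4$ minus one edge. -}

module Defs where

open import Data.Nat using (ℕ; zero; suc; _≤_) renaming (_<_ to _<ℕ_)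
open import Data.Fin using (Fin; toℕ) renaming (_<_ to _<ᶠ_)
open import Data.Product using (Σ; ∃; ∃-syntax; _×_; _,_)
open import Data.Sum using (_⊎_)
open import Data.Empty using (⊥)
open import Relation.Nullary using (¬_)
open import Relation.Binary.PropositionalEquality using (_≡_; _≢_)
open import Function.Bundles using (_⇔_; _⤖_; Bijection)
open import Function.Definitions using (Injective)

record Graph (n : ℕ) : Set₁ where
  field
    Adj    : Fin n → Fin n → Set
    sym    : ∀ {x y} → Adj x y → Adj y x
    irrefl : ∀ {x} → ¬ Adj x x
open Graph public

data Reach {n : ℕ} (G : Graph n) : Fin n → Fin n → Set where
  here : ∀ {x} → Reach G x x
  step : ∀ {x y z} → Adj G x y → Reach G y z → Reach G x z

Connected : ∀ {n} → Graph n → Set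
Connected G = ∀ x y → Reach G x y

ContainsInduced : ∀ {n} → Graph n → (k : ℕ) → (Fin k → Fin k → Set) → Set
ContainsInduced {n} G k H =
  Σ (Fin k → Fin n) λ f → Injective _≡_ _≡_ f × (∀ i j → H i j ⇔ Adj G (f i) (f j))

-- Diamond: K4 on {0,1,2,3} minus the edge {0,3}.
DiamondAdj : Fin 4 → Fin 4 → Set
DiamondAdj i j = (toℕ i ≢ toℕ j) × ¬ (toℕ i ≡ 0 × toℕ j ≡ 3) × ¬ (toℕ i ≡ 3 × toℕ j ≡ 0)

-- k-pan on Fin (suc k): cycle 0 - 1 - ... - (k-1) - 0, plus vertex k adjacent to 0 only.
CycleEdge : ℕ → ℕ → ℕ → Set
CycleEdge k a b = a <ℕ k × b <ℕ k ×
  (suc a ≡ b ⊎ suc b ≡ a ⊎ (a ≡ 0 × suc b ≡ k) ⊎ (b ≡ 0 × suc a ≡ k))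

PanAdj : (k : ℕ) → Fin (suc k) → Fin (suc k) → Set
PanAdj k i j = CycleEdge k (toℕ i) (toℕ j)
  ⊎ (toℕ i ≡ 0 × toℕ j ≡ k) ⊎ (toℕ j ≡ 0 × toℕ i ≡ k)

-- An ordering σ of V(G) = Fin n: a bijection sending each vertex to its position.
Ordering : ℕ → Set
Ordering n = Fin n ⤖ Fin n

_<[_]_ : ∀ {n} → Fin n → Ordering n → Fin n → Set
x <[ σ ] y = Bijection.to σ x <ᶠ Bijection.to σ y

IsDFS : ∀ {n} → Graph n → Ordering n → Set
IsDFS G σ = ∀ a b c → a <[ σ ] b → b <[ σ ] c → Adj G a c → ¬ Adj G a b →
  ∃[ d ] (a <[ σ ] d × d <[ σ ] b × Adj G d b)

IsLexDFS : ∀ {n} → Graph n → Ordering n → Set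
IsLexDFS G σ = ∀ a b c → a <[ σ ] b → b <[ σ ] c → Adj G a c → ¬ Adj G a b →
  ∃[ d ] (a <[ σ ] d × d <[ σ ] b × Adj G d b × ¬ Adj G d c)

{-# OPTIONS --safe #-}
module Submission where

-- Conversely, let σ be a
-- DFS ordering, a <σ b <σ c with ac ∈ E and ab ∉ E, and let d be a DFS witness:
-- a <σ d <σ b and db ∈ E. Suppose dc ∈ E. Applying the DFS condition to (a, y, c)
-- over and over walks from y = d down to a, giving a path P = q₀ … qₘ from d to a
-- that stays σ-below d, hence avoids b and c. Then P + c is a cycle and b is a
-- handle at q₀: b ∼ q₀ but b ≁ qₘ. A handled cycle always yields a shorter one:
-- cut at an interior neighbour of c or of b, or shortcut a chord of P. When there
-- is none, P + c is an induced cycle and b is a pendant vertex at q₀ (a pan),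
-- unless b ∼ c, which gives a diamond when q₀ ∼ qₘ and otherwise the handled
-- triangle c q₀ b with handle qₘ. So handled cycles do not exist.

open import Defs
open import Data.Nat using (ℕ; suc; _≤_)
open import Relation.Nullary using (¬_)
open import Function.Bundles using (_⇔_)

open import Data.Nat using (zero; _+_; _∸_; _<_; z≤n; s≤s; z<s; _<?_; anyUpTo?)
open import Data.Nat.Properties
  using ( ≤-refl; ≤-reflexive; ≤-trans; <⇒≤; <⇒≢; <-cmp; n≤1+n; 1+n≰n; n≮n
        ; m≤n⇒m≤1+n; m≤n⇒m<n∨m≡n; m<n⇒m<1+n; suc-injective; +-cancelʳ-≡
        ; +-monoˡ-≤; +-monoˡ-<; +-suc; +-assoc; +-comm; m≤m+n; n≢0⇒n>0
        ; ∸-monoʳ-<; m∸n+n≡m; m≤n⇒∃[o]m+o≡n )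
open import Data.Nat.Induction using (<-rec)
open import Data.Fin using (Fin; toℕ) renaming (suc to fsuc)
open import Data.Fin.Patterns using (0F; 1F; 2F; 3F)
open import Data.Fin.Properties using (toℕ-injective; toℕ≤pred[n])
  renaming (<-trans to <ᶠ-trans; <-irrefl to <ᶠ-irrefl; <-asym to <ᶠ-asym)
open import Data.Fin.Induction using () renaming (<-wellFounded to <ᶠ-wellFounded)
open import Data.Product using (∃; ∃₂; _×_; _,_)
open import Data.Sum using (_⊎_; inj₁; inj₂; map₂)
open import Data.Empty using (⊥-elim)
open import Function.Base using (_∘_; const)
open import Function.Bundles using (mk⇔; Equivalence; Bijection)
open import Induction.WellFounded using (WellFounded; Acc; acc)
import Relation.Binary.Construct.On as On
open import Relation.Binary.Definitions using (Decidable; tri<; tri≈; tri>)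
open import Relation.Binary.PropositionalEquality
  using (_≡_; _≢_; refl; cong; subst; subst₂; trans; module ≡-Reasoning)
  renaming (sym to ≡-sym)
open import Relation.Nullary using (Dec; yes; no)
open import Relation.Nullary.Decidable using (_×-dec_; ¬¬-excluded-middle)

_◂_ : ∀ {n} → Fin n → (ℕ → Fin n) → ℕ → Fin n
(x ◂ q) zero    = x
(x ◂ q) (suc t) = q t

Avoids : ∀ {n} → (ℕ → Fin n) → ℕ → Fin n → Set
Avoids q m x = ∀ {t} → t ≤ m → q t ≢ x

skip : ℕ → ℕ → ℕ → ℕ
skip i       d zero    = zero
skip zero    d (suc t) = suc t + d
skip (suc i) d (suc t) = suc (skip i d t)

skip-low : ∀ {i d t} → t ≤ i → skip i d t ≡ t
skip-low {i}     {t = zero}  _           = refl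
skip-low {suc i} {t = suc t} (s≤s t≤i) = cong suc (skip-low t≤i)

skip-high : ∀ {i d t} → i < t → skip i d t ≡ t + d
skip-high {zero}  {t = suc t} _           = refl
skip-high {suc i} {t = suc t} (s≤s i<t) = cong suc (skip-high i<t)

skip-≤ : ∀ i d t → skip i d t ≤ t + d
skip-≤ i       d zero    = z≤n
skip-≤ zero    d (suc t) = ≤-refl
skip-≤ (suc i) d (suc t) = s≤s (skip-≤ i d t)

skip-bound : ∀ {i d m t} → t ≤ m → skip i d t ≤ m + d
skip-bound {i} {d} {t = t} t≤m = ≤-trans (skip-≤ i d t) (+-monoˡ-≤ d t≤m)

skip-injective : ∀ i d {s t} → skip i d s ≡ skip i d t → s ≡ t
skip-injective i       d {zero}  {zero}  _ = refl
skip-injective zero    d {zero}  {suc t} ()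
skip-injective (suc i) d {zero}  {suc t} ()
skip-injective zero    d {suc s} {zero}  ()
skip-injective (suc i) d {suc s} {zero}  ()
skip-injective zero    d {suc s} {suc t} e = +-cancelʳ-≡ d (suc s) (suc t) e
skip-injective (suc i) d {suc s} {suc t} e = cong suc (skip-injective i d (suc-injective e))

PanEdge : ℕ → ℕ → ℕ → Set
PanEdge k s t = CycleEdge k s t ⊎ (s ≡ 0 × t ≡ k) ⊎ (t ≡ 0 × s ≡ k)

CycleEdge-sym : ∀ {k s t} → CycleEdge k s t → CycleEdge k t s
CycleEdge-sym (s<k , t<k , inj₁ e)               = t<k , s<k , inj₂ (inj₁ e)
CycleEdge-sym (s<k , t<k , inj₂ (inj₁ e))        = t<k , s<k , inj₁ e
CycleEdge-sym (s<k , t<k , inj₂ (inj₂ (inj₁ e))) = t<k , s<k , inj₂ (inj₂ (inj₂ e))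
CycleEdge-sym (s<k , t<k , inj₂ (inj₂ (inj₂ e))) = t<k , s<k , inj₂ (inj₂ (inj₁ e))

PanEdge-sym : ∀ {k s t} → PanEdge k s t → PanEdge k t s
PanEdge-sym (inj₁ e)        = inj₁ (CycleEdge-sym e)
PanEdge-sym (inj₂ (inj₁ e)) = inj₂ (inj₂ e)
PanEdge-sym (inj₂ (inj₂ e)) = inj₂ (inj₁ e)

PanEdge-irrefl : ∀ m {s} → ¬ PanEdge (2 + m) s s
PanEdge-irrefl m (inj₁ (_ , _ , inj₁ ()))
PanEdge-irrefl m (inj₁ (_ , _ , inj₂ (inj₁ ())))
PanEdge-irrefl m (inj₁ (_ , _ , inj₂ (inj₂ (inj₁ (refl , ())))))
PanEdge-irrefl m (inj₁ (_ , _ , inj₂ (inj₂ (inj₂ (refl , ())))))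
PanEdge-irrefl m (inj₂ (inj₁ (refl , ())))
PanEdge-irrefl m (inj₂ (inj₂ (refl , ())))

-- Pan vertex t of a handled cycle of length m: qₜ for t ≤ m, then c, then the pendant b.
data Slot (m : ℕ) : ℕ → Set where
  on-path : ∀ {t} → t ≤ m → Slot m t
  closing : Slot m (suc m)
  pendant : Slot m (suc (suc m))

slot : ∀ m {t} → t ≤ 2 + m → Slot m t
slot m       {zero}  _ = on-path z≤n
slot zero    {1}     _ = closing
slot zero    {2}     _ = pendant
slot zero    {suc (suc (suc t))} (s≤s (s≤s ()))
slot (suc m) {suc t} (s≤s t≤) = shift (slot m t≤)
  where
  shift : ∀ {m t} → Slot m t → Slot (suc m) (suc t)
  shift (on-path t≤m) = on-path (s≤s t≤m)
  shift closing       = closing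
  shift pendant       = pendant

on-path< : ∀ {m t} → t ≤ m → t < 2 + m
on-path< t≤m = s≤s (m≤n⇒m≤1+n t≤m)

module _ {n} (G : Graph n) where

  private
    infix 4 _∼_
    _∼_ : Fin n → Fin n → Set
    _∼_ = Adj G

    ∼-sym : ∀ {x y} → x ∼ y → y ∼ x
    ∼-sym = Graph.sym G

    ∼⇒≢ : ∀ {x y} → x ∼ y → x ≢ y
    ∼⇒≢ x∼y refl = irrefl G x∼y

  record Path (q : ℕ → Fin n) (m : ℕ) : Set where
    field
      walk      : ∀ {t} → t < m → q t ∼ q (suc t)
      injective : ∀ {s t} → s ≤ m → t ≤ m → q s ≡ q t → s ≡ t

  path-const : ∀ x → Path (const x) 0
  path-const x = record { walk = λ () ; injective = λ { z≤n z≤n _ → refl } }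

  path-cons : ∀ {y q m} → y ∼ q 0 → Avoids q m y → Path q m → Path (y ◂ q) (suc m)
  path-cons {y} {q} {m} y∼q₀ y∉q p = record { walk = walk ; injective = injective }
    where
    walk : ∀ {t} → t < suc m → (y ◂ q) t ∼ (y ◂ q) (suc t)
    walk {zero}  _         = y∼q₀
    walk {suc t} (s≤s t<m) = Path.walk p t<m
    injective : ∀ {s t} → s ≤ suc m → t ≤ suc m → (y ◂ q) s ≡ (y ◂ q) t → s ≡ t
    injective {zero}  {zero}  _         _         _ = refl
    injective {zero}  {suc t} _         (s≤s t≤m) e = ⊥-elim (y∉q t≤m (≡-sym e))
    injective {suc s} {zero}  (s≤s s≤m) _         e = ⊥-elim (y∉q s≤m e)
    injective {suc s} {suc t} (s≤s s≤m) (s≤s t≤m) e = cong suc (Path.injective p s≤m t≤m e)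

  path-prefix : ∀ {q m t} → t ≤ m → Path q m → Path q t
  path-prefix t≤m p = record
    { walk      = λ s<t → Path.walk p (≤-trans s<t t≤m)
    ; injective = λ s≤t s′≤t → Path.injective p (≤-trans s≤t t≤m) (≤-trans s′≤t t≤m)
    }

  path-suffix : ∀ {q r t} → Path q (r + t) → Path (λ s → q (s + t)) r
  path-suffix {t = t} p = record
    { walk      = λ s<r → Path.walk p (+-monoˡ-< t s<r)
    ; injective = λ {s} {s′} s≤r s′≤r e →
        +-cancelʳ-≡ t s s′ (Path.injective p (+-monoˡ-≤ t s≤r) (+-monoˡ-≤ t s′≤r) e)
    }

  path-shortcut : ∀ {q m i d} → q i ∼ q (suc i + d) → Path q (m + d) → Path (q ∘ skip i d) m
  path-shortcut {q} {m} {i} {d} chord p = record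
    { walk      = walk
    ; injective = λ s≤m t≤m e →
        skip-injective i d (Path.injective p (skip-bound s≤m) (skip-bound t≤m) e)
    }
    where
    walk : ∀ {t} → t < m → q (skip i d t) ∼ q (skip i d (suc t))
    walk {t} t<m with <-cmp t i
    ... | tri< t<i _ _ rewrite skip-low {i} {d} (<⇒≤ t<i) | skip-low {i} {d} t<i =
      Path.walk p (≤-trans t<m (m≤m+n m d))
    ... | tri≈ _ refl _ rewrite skip-low {i} {d} (≤-refl {i}) | skip-high {i} {d} (≤-refl {suc i}) =
      chord
    ... | tri> _ _ i<t rewrite skip-high {i} {d} i<t | skip-high {i} {d} (m<n⇒m<1+n i<t) =
      Path.walk p (+-monoˡ-< d t<m)

  InteriorNeighbour : (ℕ → Fin n) → ℕ → Fin n → Set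
  InteriorNeighbour q m x = ∃ λ t → t < m × (0 < t × q t ∼ x)

  Chord : (ℕ → Fin n) → ℕ → Set
  Chord q m = ∃ λ j → j < suc m × ∃ λ i → i < j × (suc i < j × q i ∼ q j)

  record HandledCycle (m : ℕ) : Set where
    field
      q    : ℕ → Fin n
      b c  : Fin n
      path : Path q m
      b∉q  : Avoids q m b
      c∉q  : Avoids q m c
      q₀∼b : q 0 ∼ b
      c∼q₀ : c ∼ q 0
      qₘ∼c : q m ∼ c
      qₘ≁b : ¬ q m ∼ b

  module _ {m} (hc : HandledCycle m) where
    open HandledCycle hc
    open Path path

    b≢c : b ≢ c
    b≢c refl = qₘ≁b qₘ∼c

    0<m : 0 < m
    0<m = n≢0⇒n>0 λ { refl → qₘ≁b q₀∼b }

    prefix : ∀ {t} → t ≤ m → q t ∼ c → ¬ q t ∼ b → HandledCycle t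
    prefix t≤m qₜ∼c qₜ≁b = record
      { q = q ; b = b ; c = c ; path = path-prefix t≤m path
      ; b∉q = λ s≤t → b∉q (≤-trans s≤t t≤m) ; c∉q = λ s≤t → c∉q (≤-trans s≤t t≤m)
      ; q₀∼b = q₀∼b ; c∼q₀ = c∼q₀ ; qₘ∼c = qₜ∼c ; qₘ≁b = qₜ≁b
      }

    prefix-swapped : ∀ {t} → t ≤ m → q t ∼ b → ¬ q t ∼ c → HandledCycle t
    prefix-swapped t≤m qₜ∼b qₜ≁c = record
      { q = q ; b = c ; c = b ; path = path-prefix t≤m path
      ; b∉q = λ s≤t → c∉q (≤-trans s≤t t≤m) ; c∉q = λ s≤t → b∉q (≤-trans s≤t t≤m)
      ; q₀∼b = ∼-sym c∼q₀ ; c∼q₀ = ∼-sym q₀∼b ; qₘ∼c = qₜ∼b ; qₘ≁b = qₜ≁c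
      }

    suffix : ∀ {r t} → r + t ≡ m → q t ∼ c → q t ∼ b → HandledCycle r
    suffix {t = t} refl qₜ∼c qₜ∼b = record
      { q = λ s → q (s + t) ; b = b ; c = c ; path = path-suffix path
      ; b∉q = λ s≤r → b∉q (+-monoˡ-≤ t s≤r) ; c∉q = λ s≤r → c∉q (+-monoˡ-≤ t s≤r)
      ; q₀∼b = qₜ∼b ; c∼q₀ = ∼-sym qₜ∼c ; qₘ∼c = qₘ∼c ; qₘ≁b = qₘ≁b
      }

    shortcut : ∀ {i e r} → 2 + i + e + r ≡ m → q i ∼ q (2 + i + e) → HandledCycle (suc i + r)
    shortcut {i} {e} {r} refl chord = record
      { q = q ∘ skip i (suc e) ; b = b ; c = c
      ; path = path-shortcut (subst (λ j → q i ∼ q (suc j)) (≡-sym (+-suc i e)) chord)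
                             (subst (Path q) (≡-sym length) path)
      ; b∉q = b∉q ∘ bound ; c∉q = c∉q ∘ bound
      ; q₀∼b = q₀∼b ; c∼q₀ = c∼q₀
      ; qₘ∼c = subst (λ j → q j ∼ c) (≡-sym end) qₘ∼c
      ; qₘ≁b = subst (λ j → ¬ q j ∼ b) (≡-sym end) qₘ≁b
      }
      where
      open ≡-Reasoning
      length : suc i + r + suc e ≡ 2 + i + e + r
      length = cong suc (begin
        i + r + suc e     ≡⟨ +-suc (i + r) e ⟩
        suc (i + r + e)   ≡⟨ cong suc (+-assoc i r e) ⟩
        suc (i + (r + e)) ≡⟨ cong (λ x → suc (i + x)) (+-comm r e) ⟩
        suc (i + (e + r)) ≡⟨ cong suc (≡-sym (+-assoc i e r)) ⟩
        suc (i + e + r)   ∎)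
      bound : ∀ {t} → t ≤ suc i + r → skip i (suc e) t ≤ 2 + i + e + r
      bound t≤m′ = ≤-trans (skip-bound {i = i} t≤m′) (≤-reflexive length)
      end : skip i (suc e) (suc i + r) ≡ 2 + i + e + r
      end = trans (skip-high (s≤s (m≤m+n i r))) length

    triangle : b ∼ c → ¬ q 0 ∼ q m → HandledCycle 1
    triangle b∼c q₀≁qₘ = record
      { q = c ◂ const (q 0) ; b = q m ; c = b
      ; path = path-cons c∼q₀ (λ _ → c∉q z≤n) (path-const (q 0))
      ; b∉q = λ { {zero} _ → c∉q ≤-refl ∘ ≡-sym ; {suc _} _ → <⇒≢ 0<m ∘ injective z≤n ≤-refl }
      ; c∉q = λ { {zero} _ → b≢c ∘ ≡-sym ; {suc _} _ → b∉q z≤n }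
      ; q₀∼b = ∼-sym qₘ∼c ; c∼q₀ = b∼c ; qₘ∼c = q₀∼b ; qₘ≁b = q₀≁qₘ
      }

    module _ (no-chord : ¬ Chord q m) (b-free : ¬ InteriorNeighbour q m b)
             (c-free : ¬ InteriorNeighbour q m c) (b≁c : ¬ b ∼ c) where

      private
        consecutive : ∀ {s t} → s ≤ m → t ≤ m → q s ∼ q t → suc s ≡ t ⊎ suc t ≡ s
        consecutive {s} {t} s≤m t≤m qₛ∼qₜ with <-cmp s t
        ... | tri< s<t _ _ with m≤n⇒m<n∨m≡n s<t
        ...   | inj₁ 1+s<t = ⊥-elim (no-chord (t , s≤s t≤m , s , s<t , 1+s<t , qₛ∼qₜ))
        ...   | inj₂ 1+s≡t = inj₁ 1+s≡t
        consecutive s≤m t≤m qₛ∼qₜ | tri≈ _ refl _ = ⊥-elim (irrefl G qₛ∼qₜ)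
        consecutive {s} {t} s≤m t≤m qₛ∼qₜ | tri> _ _ t<s with m≤n⇒m<n∨m≡n t<s
        ... | inj₁ 1+t<s = ⊥-elim (no-chord (s , s≤s s≤m , t , t<s , 1+t<s , ∼-sym qₛ∼qₜ))
        ... | inj₂ 1+t≡s = inj₂ 1+t≡s

        path-edge : ∀ {s t} → s ≤ m → t ≤ m → PanEdge (2 + m) s t ⇔ q s ∼ q t
        path-edge s≤m t≤m = mk⇔ to from
          where
          to : PanEdge (2 + m) _ _ → q _ ∼ q _
          to (inj₁ (_ , _ , inj₁ refl))                         = walk t≤m
          to (inj₁ (_ , _ , inj₂ (inj₁ refl)))                  = ∼-sym (walk s≤m)
          to (inj₁ (_ , _ , inj₂ (inj₂ (inj₁ (_ , refl)))))     = ⊥-elim (1+n≰n t≤m)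
          to (inj₁ (_ , _ , inj₂ (inj₂ (inj₂ (_ , refl)))))     = ⊥-elim (1+n≰n s≤m)
          to (inj₂ (inj₁ (_ , refl))) = ⊥-elim (1+n≰n (≤-trans (n≤1+n _) t≤m))
          to (inj₂ (inj₂ (_ , refl))) = ⊥-elim (1+n≰n (≤-trans (n≤1+n _) s≤m))
          from : q _ ∼ q _ → PanEdge (2 + m) _ _
          from qₛ∼qₜ = inj₁ (on-path< s≤m , on-path< t≤m , map₂ inj₁ (consecutive s≤m t≤m qₛ∼qₜ))

        closing-edge : ∀ {s} → s ≤ m → PanEdge (2 + m) s (suc m) ⇔ q s ∼ c
        closing-edge s≤m = mk⇔ to (from _ s≤m)
          where
          to : PanEdge (2 + m) _ (suc m) → q _ ∼ c
          to (inj₁ (_ , _ , inj₁ refl))                     = qₘ∼c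
          to (inj₁ (_ , _ , inj₂ (inj₁ refl)))              = ⊥-elim (1+n≰n (≤-trans (n≤1+n _) s≤m))
          to (inj₁ (_ , _ , inj₂ (inj₂ (inj₁ (refl , _))))) = ∼-sym c∼q₀
          to (inj₁ (_ , _ , inj₂ (inj₂ (inj₂ (() , _)))))
          to (inj₂ (inj₁ (_ , ())))
          to (inj₂ (inj₂ (() , _)))
          from : ∀ s → s ≤ m → q s ∼ c → PanEdge (2 + m) s (suc m)
          from zero    _   _ = inj₁ (z<s , ≤-refl , inj₂ (inj₂ (inj₁ (refl , refl))))
          from (suc s) s≤m qₛ∼c with m≤n⇒m<n∨m≡n s≤m
          ... | inj₁ s<m  = ⊥-elim (c-free (suc s , s<m , z<s , qₛ∼c))
          ... | inj₂ refl = inj₁ (on-path< s≤m , ≤-refl , inj₁ refl)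

        pendant-edge : ∀ {s} → s ≤ m → PanEdge (2 + m) s (2 + m) ⇔ q s ∼ b
        pendant-edge s≤m = mk⇔ to (from _ s≤m)
          where
          to : PanEdge (2 + m) _ (2 + m) → q _ ∼ b
          to (inj₁ (_ , 2+m<2+m , _)) = ⊥-elim (n≮n _ 2+m<2+m)
          to (inj₂ (inj₁ (refl , _))) = q₀∼b
          to (inj₂ (inj₂ (() , _)))
          from : ∀ s → s ≤ m → q s ∼ b → PanEdge (2 + m) s (2 + m)
          from zero    _   _ = inj₂ (inj₁ (refl , refl))
          from (suc s) s≤m qₛ∼b with m≤n⇒m<n∨m≡n s≤m
          ... | inj₁ s<m  = ⊥-elim (b-free (suc s , s<m , z<s , qₛ∼b))
          ... | inj₂ refl = ⊥-elim (qₘ≁b qₛ∼b)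

        closing-pendant-edge : PanEdge (2 + m) (suc m) (2 + m) ⇔ c ∼ b
        closing-pendant-edge = mk⇔ to (λ c∼b → ⊥-elim (b≁c (∼-sym c∼b)))
          where
          to : PanEdge (2 + m) (suc m) (2 + m) → c ∼ b
          to (inj₁ (_ , 2+m<2+m , _)) = ⊥-elim (n≮n _ 2+m<2+m)
          to (inj₂ (inj₁ (() , _)))
          to (inj₂ (inj₂ (() , _)))

        loop : ∀ {s x} → PanEdge (2 + m) s s ⇔ x ∼ x
        loop = mk⇔ (⊥-elim ∘ PanEdge-irrefl m) (⊥-elim ∘ irrefl G)

        flip : ∀ {k s t x y} → PanEdge k s t ⇔ x ∼ y → PanEdge k t s ⇔ y ∼ x
        flip e = mk⇔ (∼-sym ∘ Equivalence.to e ∘ PanEdge-sym)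
                     (PanEdge-sym ∘ Equivalence.from e ∘ ∼-sym)

        vertex : ∀ {t} → Slot m t → Fin n
        vertex {t} (on-path _) = q t
        vertex closing         = c
        vertex pendant         = b

        vertex-adjacency : ∀ {s t} (σ : Slot m s) (τ : Slot m t)
                         → PanEdge (2 + m) s t ⇔ vertex σ ∼ vertex τ
        vertex-adjacency (on-path s≤m) (on-path t≤m) = path-edge s≤m t≤m
        vertex-adjacency (on-path s≤m) closing       = closing-edge s≤m
        vertex-adjacency (on-path s≤m) pendant       = pendant-edge s≤m
        vertex-adjacency closing       (on-path t≤m) = flip (closing-edge t≤m)
        vertex-adjacency closing       closing       = loop
        vertex-adjacency closing       pendant       = closing-pendant-edge
        vertex-adjacency pendant       (on-path t≤m) = flip (pendant-edge t≤m)
        vertex-adjacency pendant       closing       = flip closing-pendant-edge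
        vertex-adjacency pendant       pendant       = loop

        vertex-injective : ∀ {s t} (σ : Slot m s) (τ : Slot m t) → vertex σ ≡ vertex τ → s ≡ t
        vertex-injective (on-path s≤m) (on-path t≤m) e = injective s≤m t≤m e
        vertex-injective (on-path s≤m) closing       e = ⊥-elim (c∉q s≤m e)
        vertex-injective (on-path s≤m) pendant       e = ⊥-elim (b∉q s≤m e)
        vertex-injective closing       (on-path t≤m) e = ⊥-elim (c∉q t≤m (≡-sym e))
        vertex-injective closing       closing       _ = refl
        vertex-injective closing       pendant       e = ⊥-elim (b≢c (≡-sym e))
        vertex-injective pendant       (on-path t≤m) e = ⊥-elim (b∉q t≤m (≡-sym e))
        vertex-injective pendant       closing       e = ⊥-elim (b≢c e)
        vertex-injective pendant       pendant       _ = refl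

        slotₚ : (i : Fin (3 + m)) → Slot m (toℕ i)
        slotₚ i = slot m (toℕ≤pred[n] i)

      induced-pan : ContainsInduced G (3 + m) (PanAdj (2 + m))
      induced-pan = vertex ∘ slotₚ
                  , (λ e → toℕ-injective (vertex-injective (slotₚ _) (slotₚ _) e))
                  , (λ i j → vertex-adjacency (slotₚ i) (slotₚ j))

  induced-diamond : ∀ {w₀ w₁ w₂ w₃} → w₀ ∼ w₁ → w₀ ∼ w₂ → w₁ ∼ w₂ → w₁ ∼ w₃ → w₂ ∼ w₃
                  → ¬ w₀ ∼ w₃ → w₀ ≢ w₃ → ContainsInduced G 4 DiamondAdj
  induced-diamond {w₀} {w₁} {w₂} {w₃} e₀₁ e₀₂ e₁₂ e₁₃ e₂₃ n₀₃ w₀≢w₃ =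
    w , w-injective , λ i j → mk⇔ (edge i j) (non-edge i j)
    where
    w : Fin 4 → Fin n
    w 0F = w₀
    w 1F = w₁
    w 2F = w₂
    w 3F = w₃

    edge : ∀ i j → DiamondAdj i j → w i ∼ w j
    edge 0F 1F _ = e₀₁
    edge 0F 2F _ = e₀₂
    edge 1F 2F _ = e₁₂
    edge 1F 3F _ = e₁₃
    edge 2F 3F _ = e₂₃
    edge 1F 0F _ = ∼-sym e₀₁
    edge 2F 0F _ = ∼-sym e₀₂
    edge 2F 1F _ = ∼-sym e₁₂
    edge 3F 1F _ = ∼-sym e₁₃
    edge 3F 2F _ = ∼-sym e₂₃
    edge 0F 3F (_ , ¬03 , _) = ⊥-elim (¬03 (refl , refl))
    edge 3F 0F (_ , _ , ¬30) = ⊥-elim (¬30 (refl , refl))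
    edge 0F 0F (i≢j , _) = ⊥-elim (i≢j refl)
    edge 1F 1F (i≢j , _) = ⊥-elim (i≢j refl)
    edge 2F 2F (i≢j , _) = ⊥-elim (i≢j refl)
    edge 3F 3F (i≢j , _) = ⊥-elim (i≢j refl)

    along : ∀ {i j k l} → toℕ i ≡ toℕ k → toℕ j ≡ toℕ l → w i ∼ w j → w k ∼ w l
    along i≡k j≡l = subst₂ (λ k l → w k ∼ w l) (toℕ-injective i≡k) (toℕ-injective j≡l)

    non-edge : ∀ i j → w i ∼ w j → DiamondAdj i j
    non-edge i j wᵢ∼wⱼ =
        (λ i≡j → irrefl G (along refl (≡-sym i≡j) wᵢ∼wⱼ))
      , (λ { (i≡0 , j≡3) → n₀₃ (along {k = 0F} {l = 3F} i≡0 j≡3 wᵢ∼wⱼ) })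
      , (λ { (i≡3 , j≡0) → n₀₃ (∼-sym (along {k = 3F} {l = 0F} i≡3 j≡0 wᵢ∼wⱼ)) })

    w-injective : ∀ {i j} → w i ≡ w j → i ≡ j
    w-injective {0F} {0F} _ = refl
    w-injective {1F} {1F} _ = refl
    w-injective {2F} {2F} _ = refl
    w-injective {3F} {3F} _ = refl
    w-injective {0F} {3F} e = ⊥-elim (w₀≢w₃ e)
    w-injective {3F} {0F} e = ⊥-elim (w₀≢w₃ (≡-sym e))
    w-injective {0F} {1F} e = ⊥-elim (∼⇒≢ e₀₁ e)
    w-injective {0F} {2F} e = ⊥-elim (∼⇒≢ e₀₂ e)
    w-injective {1F} {2F} e = ⊥-elim (∼⇒≢ e₁₂ e)
    w-injective {1F} {3F} e = ⊥-elim (∼⇒≢ e₁₃ e)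
    w-injective {2F} {3F} e = ⊥-elim (∼⇒≢ e₂₃ e)
    w-injective {1F} {0F} e = ⊥-elim (∼⇒≢ e₀₁ (≡-sym e))
    w-injective {2F} {0F} e = ⊥-elim (∼⇒≢ e₀₂ (≡-sym e))
    w-injective {2F} {1F} e = ⊥-elim (∼⇒≢ e₁₂ (≡-sym e))
    w-injective {3F} {1F} e = ⊥-elim (∼⇒≢ e₁₃ (≡-sym e))
    w-injective {3F} {2F} e = ⊥-elim (∼⇒≢ e₂₃ (≡-sym e))

module _ {n} (G : Graph n) (_∼?_ : Decidable (Adj G))
         (no-diamond : ¬ ContainsInduced G 4 DiamondAdj)
         (no-pan : ∀ k → 3 ≤ k → ¬ ContainsInduced G (suc k) (PanAdj k)) where

  private
    infix 4 _∼_
    _∼_ : Fin n → Fin n → Set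
    _∼_ = Adj G

    interior-neighbour? : ∀ q m x → Dec (InteriorNeighbour G q m x)
    interior-neighbour? q m x = anyUpTo? (λ t → (0 <? t) ×-dec (q t ∼? x)) m

    chord? : ∀ q m → Dec (Chord G q m)
    chord? q m = anyUpTo? (λ j → anyUpTo? (λ i → (suc i <? j) ×-dec (q i ∼? q j)) j) (suc m)

  Shorter : ℕ → Set
  Shorter m = ∃ λ m′ → m′ < m × HandledCycle G m′

  module _ {m} (hc : HandledCycle G m) where
    open HandledCycle hc
    open Path path

    private
      via-c-neighbour : InteriorNeighbour G q m c → Shorter m
      via-c-neighbour (t , t<m , 0<t , qₜ∼c) with q t ∼? b
      ... | no qₜ≁b  = t , t<m , prefix G hc (<⇒≤ t<m) qₜ∼c qₜ≁b
      ... | yes qₜ∼b =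
        m ∸ t , ∸-monoʳ-< 0<t (<⇒≤ t<m) , suffix G hc (m∸n+n≡m (<⇒≤ t<m)) qₜ∼c qₜ∼b

      via-chord : Chord G q m → Shorter m
      via-chord (j , s≤s j≤m , i , _ , 1+i<j , qᵢ∼qⱼ) with m≤n⇒∃[o]m+o≡n 1+i<j
      ... | e , refl with m≤n⇒∃[o]m+o≡n j≤m
      ... | r , refl =
        suc i + r , s≤s (+-monoˡ-≤ r (m≤m+n (suc i) e)) , shortcut G hc refl qᵢ∼qⱼ

      1<m : ¬ q 0 ∼ q m → 1 < m
      1<m q₀≁qₘ with m≤n⇒m<n∨m≡n (0<m G hc)
      ... | inj₁ 1<m = 1<m
      ... | inj₂ refl = ⊥-elim (q₀≁qₘ (walk z<s))

      via-induced-cycle : ¬ Chord G q m → ¬ InteriorNeighbour G q m b → ¬ InteriorNeighbour G q m c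
                        → Shorter m
      via-induced-cycle no-chord b-free c-free with b ∼? c | q 0 ∼? q m
      ... | no b≁c  | _ =
        ⊥-elim (no-pan (2 + m) (s≤s (s≤s (0<m G hc))) (induced-pan G hc no-chord b-free c-free b≁c))
      ... | yes b∼c | yes q₀∼qₘ = ⊥-elim (no-diamond
            (induced-diamond G (sym G q₀∼b) b∼c (sym G c∼q₀) q₀∼qₘ (sym G qₘ∼c)
                               (qₘ≁b ∘ sym G) (b∉q ≤-refl ∘ ≡-sym)))
      ... | yes b∼c | no q₀≁qₘ = 1 , 1<m q₀≁qₘ , triangle G hc b∼c q₀≁qₘ

    shrink : Shorter m
    shrink with interior-neighbour? q m c
    ... | yes c-neighbour = via-c-neighbour c-neighbour
    ... | no c-free with interior-neighbour? q m b
    ...   | yes (t , t<m , 0<t , qₜ∼b) =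
            t , t<m , prefix-swapped G hc (<⇒≤ t<m) qₜ∼b (λ qₜ∼c → c-free (t , t<m , 0<t , qₜ∼c))
    ...   | no b-free with chord? q m
    ...     | yes chord    = via-chord chord
    ...     | no no-chord = via-induced-cycle no-chord b-free c-free

  no-handled-cycle : ∀ m → ¬ HandledCycle G m
  no-handled-cycle = <-rec (λ m → ¬ HandledCycle G m) λ m shorter-impossible hc →
    let m′ , m′<m , hc′ = shrink hc in shorter-impossible m′<m hc′

module _ {n} (G : Graph n) (_∼?_ : Decidable (Adj G)) (σ : Ordering n) (dfs : IsDFS G σ) where

  private
    _∼_ : Fin n → Fin n → Set
    _∼_ = Adj G

    _≺_ : Fin n → Fin n → Set
    x ≺ y = x <[ σ ] y

    ≺-wellFounded : WellFounded _≺_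
    ≺-wellFounded = On.wellFounded (Bijection.to σ) <ᶠ-wellFounded

  NotAbove : Fin n → (ℕ → Fin n) → ℕ → Set
  NotAbove y q m = ∀ {t} → t ≤ m → ¬ y ≺ q t

  descending-path : ∀ {a c y} → a ∼ c → Acc _≺_ y → a ≺ y → y ≺ c
                  → ∃₂ λ m q → Path G q m × q 0 ≡ y × q m ≡ a × NotAbove y q m
  descending-path {a} {c} {y} a∼c (acc smaller) a≺y y≺c with a ∼? y
  ... | yes a∼y =
    1 , y ◂ const a , path-cons G (sym G a∼y) (λ { _ refl → <ᶠ-irrefl refl a≺y }) (path-const G a)
    , refl , refl , λ { {zero} _ → <ᶠ-irrefl refl ; {suc _} _ → <ᶠ-asym a≺y }
  ... | no a≁y with dfs a y c a≺y y≺c a∼c a≁y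
  ... | y′ , a≺y′ , y′≺y , y′∼y with descending-path a∼c (smaller y′≺y) a≺y′ (<ᶠ-trans y′≺y y≺c)
  ... | m , q , p , refl , qₘ≡a , below =
    suc m , y ◂ q , path-cons G (sym G y′∼y) y∉q p , refl , qₘ≡a , below′
    where
    y∉q : Avoids q m y
    y∉q t≤m qₜ≡y = below t≤m (subst (q 0 ≺_) (≡-sym qₜ≡y) y′≺y)
    below′ : NotAbove y (y ◂ q) (suc m)
    below′ {zero}  _         = <ᶠ-irrefl refl
    below′ {suc t} (s≤s t≤m) = below t≤m ∘ <ᶠ-trans y′≺y

  module _ (no-diamond : ¬ ContainsInduced G 4 DiamondAdj)
           (no-pan : ∀ k → 3 ≤ k → ¬ ContainsInduced G (suc k) (PanAdj k)) where

    dfs-witness-not-adjacent : ∀ {a b c d} → a ≺ d → d ≺ b → b ≺ c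
                             → a ∼ c → ¬ a ∼ b → d ∼ b → ¬ d ∼ c
    dfs-witness-not-adjacent {b = b} {c} {d} a≺d d≺b b≺c a∼c a≁b d∼b d∼c
      with descending-path a∼c (≺-wellFounded d) a≺d (<ᶠ-trans d≺b b≺c)
    ... | m , q , p , refl , refl , below = no-handled-cycle G _∼?_ no-diamond no-pan m record
      { q = q ; b = b ; c = c ; path = p
      ; b∉q = λ t≤m qₜ≡b → below t≤m (subst (q 0 ≺_) (≡-sym qₜ≡b) d≺b)
      ; c∉q = λ t≤m qₜ≡c → below t≤m (subst (q 0 ≺_) (≡-sym qₜ≡c) (<ᶠ-trans d≺b b≺c))
      ; q₀∼b = d∼b ; c∼q₀ = sym G d∼c ; qₘ∼c = a∼c ; qₘ≁b = a≁b
      }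

¬¬-∀-Fin : ∀ {m} {P : Fin m → Set} → (∀ i → ¬ ¬ P i) → ¬ ¬ (∀ i → P i)
¬¬-∀-Fin {zero}  _ k = k λ ()
¬¬-∀-Fin {suc m} h k =
  h 0F λ p₀ → ¬¬-∀-Fin (h ∘ fsuc) λ ps → k λ { 0F → p₀ ; (fsuc i) → ps i }

¬¬-decidable : ∀ {n} (R : Fin n → Fin n → Set) → ¬ ¬ Decidable R
¬¬-decidable R = ¬¬-∀-Fin λ x → ¬¬-∀-Fin λ y → ¬¬-excluded-middle

lemma7 : ∀ {n} (G : Graph n) → Connected G
       → ¬ ContainsInduced G 4 DiamondAdj
       → (∀ k → 3 ≤ k → ¬ ContainsInduced G (suc k) (PanAdj k))
       → (σ : Ordering n) → IsDFS G σ ⇔ IsLexDFS G σ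
lemma7 G _ no-diamond no-pan σ = mk⇔ dfs⇒lex lex⇒dfs
  where
  lex⇒dfs : IsLexDFS G σ → IsDFS G σ
  lex⇒dfs lex a b c a≺b b≺c a∼c a≁b =
    let d , a≺d , d≺b , d∼b , _ = lex a b c a≺b b≺c a∼c a≁b in d , a≺d , d≺b , d∼b

  -- Adjacency need not be decidable, but the goal ¬ d ∼ c is negative, so on the
  -- finite vertex set decidability may be assumed.
  dfs⇒lex : IsDFS G σ → IsLexDFS G σ
  dfs⇒lex dfs a b c a≺b b≺c a∼c a≁b =
    let d , a≺d , d≺b , d∼b = dfs a b c a≺b b≺c a∼c a≁b in
    d , a≺d , d≺b , d∼b , λ d∼c → ¬¬-decidable (Adj G) λ _∼?_ →
      dfs-witness-not-adjacent G _∼?_ σ dfs no-diamond no-pan a≺d d≺b b≺c a∼c a≁b d∼b d∼c
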